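{- $\mathcal{L}(\mathcal{C}_2)\sqsubset\mathcal{L}(\mathcal{C}_2,\mathcal{C}_3)\sqsubset\mathcal{L}(\mathcal{C}_2,\mathcal{C}_3,\mathcal{C}_5)\sqsubset\cdots$, where the $k$-th logic uses the counter operators $\mathcal{C}_p$ for the first $k$ primes $p$.
   Context: Write $\mathbb{B}=\{0,1\}$. Static formulas are built from propositional variables and $\top,\bot$ using $\neg,\land,\lor$. An operator automaton is $\mathcal{A}=\langle \mathbb{B}^m,Q,\delta,q_{\mathrm{init}}\rangle$ with a finite state set $Q$ of size $n$ (indexed by $[1,n]$), $\delta:Q\times\mathbb{B}^m\to Q$. Rules: static $p \;{:}{ - }\; \alpha$; delay $p \;{:}{ - }\; \ominus q$; dynamic $p_1,\dots,p_n \;{:}{ - }\; \mathcal{A}(a_1,\dots,a_m)$. A program is a finite set of rules that is nonrecursive (the graph with an edge $a\to b$ whenever $a$ occurs in the body and $b$ in the head of a rule is acyclic) and definitorial (each variable is in at most one head). Non-defined variables are input variables; an interpretation is a finite non-empty sequence $I=I_1,\dots,I_\ell$ of subsets of input variables. Satisfaction $(P,I,t)\models\cdot$: $\top$ holds, $\bot$ not; input $a$ holds iff $a\in I_t$; Boolean connectives as usual; $p$ defined by $p\;{:}{ - }\;\alpha$ iff $(P,I,t)\models\alpha$; $p$ defined by $p\;{:}{ - }\;\ominus q$ iff $(P,I,t-1)\models q$; for $p_i$ defined by a dynamic rule, $(P,I,0)\models p_i$ iff $q_{\mathrm{init}}$ is the $i$-th state, and for $t>0$, $(P,I,t)\models p_i$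 iff there are a state index $j$ and $\sigma\in\mathbb{B}^m$ (an assignment to $a_1,\dots,a_m$, identified with the conjunction of literals it makes true) with $\delta(j,\sigma)=i$, $(P,I,t-1)\models p_j$, $(P,I,t)\models\sigma$. $\mathcal{L}(\mathbf{A})$ is the set of programs with static rules, delay rules and dynamic rules with operators from $\mathbf{A}$. A program with ordered input variables and a designated variable $a$ recognises the strings $\sigma_1\dots\sigma_\ell$ over $\mathbb{B}^m$ (letters read as assignments to the input variables) with $(P,I,\ell)\models a$; the expressivity of a logic is the set of languages its programs recognise; $\mathcal{L}_1\sqsubset\mathcal{L}_2$ means the expressivity of $\mathcal{L}_1$ is strictly contained in that of $\mathcal{L}_2$. The $n$-counter operator is $\mathcal{C}_n=\langle\mathbb{B}^n,\mathbb{Z}_n,\delta,0\rangle$ with $\delta(i,b_0\dots b_{n-1})=i+j\pmod n$, where $j$ is the least $k$ with $b_k=1$, and $j=0$ if all $b_k$ are $0$. -}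

module Defs where

open import Data.Nat using (ℕ; zero; suc; _+_; _<_; _≤_; NonZero)
open import Data.Nat.DivMod using (_mod_)
open import Data.Nat.Primality using (Prime; prime⇒nonZero)
open import Data.Fin using (Fin; zero; suc; toℕ; splitAt; _↑ˡ_; _≟_)
open import Data.Bool using (Bool; true; false; not; _∧_; _∨_; if_then_else_)
open import Data.List using (List; map; allFin)
open import Data.Bool.ListAction using (or)
open import Data.List.NonEmpty using (List⁺; toList; length)
open import Data.Maybe using (Maybe; just; nothing; fromMaybe)
open import Data.Sum using (_⊎_; inj₁; inj₂)
open import Data.Product using (Σ; _×_; _,_; ∃)
open import Relation.Nullary using (¬_)
open import Relation.Nullary.Decidable using (⌊_⌋)
open import Relation.Binary.PropositionalEquality using (_≡_)

-- Operator automata  ⟨ 𝔹^m , Q , δ , q_init ⟩ with Q = [1,n] (here Fin n)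

record Automaton : Set where
  field
    m     : ℕ
    n     : ℕ
    δ     : Fin n → (Fin m → Bool) → Fin n
    qinit : Fin n

open Automaton public

firstTrue : (m : ℕ) → (Fin m → Bool) → Maybe ℕ
firstTrue zero    b = nothing
firstTrue (suc m) b with b zero
... | true  = just 0
... | false with firstTrue m (λ k → b (suc k))
...   | just j  = just (suc j)
...   | nothing = nothing

counter : (n : ℕ) → .{{NonZero n}} → Automaton
counter n = record
  { m     = n
  ; n     = n
  ; δ     = λ i b → (toℕ i + fromMaybe 0 (firstTrue n b)) mod n
  ; qinit = 0 mod n
  }

data Formula (v : ℕ) : Set where
  var  : Fin v → Formula v
  ⊤′   : Formula v
  ⊥′   : Formula v
  ¬′_  : Formula v → Formula v
  _∧′_ : Formula v → Formula v → Formula v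
  _∨′_ : Formula v → Formula v → Formula v

evalF : ∀ {v} → (Fin v → Bool) → Formula v → Bool
evalF ρ (var x)  = ρ x
evalF ρ ⊤′       = true
evalF ρ ⊥′       = false
evalF ρ (¬′ α)   = not (evalF ρ α)
evalF ρ (α ∧′ β) = evalF ρ α ∧ evalF ρ β
evalF ρ (α ∨′ β) = evalF ρ α ∨ evalF ρ β

-- A (finite, nonrecursive, definitorial) program is presented in a
-- topological order of its dependency graph: 'Prog k v' is a program with
-- k (ordered) input variables in which v variables are available
-- (the k inputs plus the heads of the rules so far).  Each new rule
-- introduces fresh head variables (definitorial) and its body mentions
-- only previously available variables (nonrecursive).
-- Fresh variables come first: in 'static'/'delay' the head is 'zero',
-- in 'dynamic' the heads p_1..p_n are 'i ↑ˡ v' for i : Fin n.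

module _ {O : Set} (ops : O → Automaton) where

  data Prog (k : ℕ) : ℕ → Set where
    inputs  : Prog k k
    static  : ∀ {v} → Prog k v → Formula v → Prog k (suc v)
    delay   : ∀ {v} → Prog k v → Fin v → Prog k (suc v)
    dynamic : ∀ {v} → Prog k v → (o : O) → (Fin (m (ops o)) → Fin v)
            → Prog k (n (ops o) + v)

  holds : ∀ {k v} → Prog k v → (ℕ → Fin k → Bool) → ℕ → Fin v → Bool
  holds inputs           I t       x       = I t x
  holds (static P α)     I t       zero    = evalF (holds P I t) α
  holds (static P α)     I t       (suc x) = holds P I t x
  holds (delay P q)      I zero    zero    = false
  holds (delay P q)      I (suc t) zero    = holds P I t q
  holds (delay P q)      I t       (suc x) = holds P I t x
  holds (dynamic {v} P o args) I t x = dyn t (splitAt (n (ops o)) x)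
    where
    dyn : ℕ → Fin (n (ops o)) ⊎ Fin v → Bool
    dyn t′       (inj₂ y) = holds P I t′ y
    dyn zero     (inj₁ i) = ⌊ qinit (ops o) ≟ i ⌋
    dyn (suc t′) (inj₁ i) =
      or (map (λ j → holds (dynamic P o args) I t′ (j ↑ˡ v)
                     ∧ ⌊ δ (ops o) j (λ r → holds P I (suc t′) (args r)) ≟ i ⌋)
              (allFin (n (ops o))))

Word : ℕ → Set
Word k = List⁺ (Fin k → Bool)

-- I_t for t = 1..ℓ is the t-th letter; I_0 = ∅ (convention)
interp : ∀ {k} → Word k → ℕ → Fin k → Bool
interp w zero    x = false
interp w (suc t) x = go (toList w) t
  where
  go : List _ → ℕ → Bool
  go List.[] _ = false
  go (a List.∷ as) zero = a x
  go (a List.∷ as) (suc s) = go as s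
  open import Data.List as List using ()

Language : ℕ → Set
Language k = Word k → Bool

Recognises : {O : Set} (ops : O → Automaton) {k : ℕ} → Language k → Set
Recognises ops {k} L =
  Σ ℕ λ v → Σ (Prog ops k v) λ P → Σ (Fin v) λ a →
    ∀ (w : Word k) → holds ops P (interp w) (length w) a ≡ L w

_⊑_ : {O₁ O₂ : Set} → (O₁ → Automaton) → (O₂ → Automaton) → Set
ops₁ ⊑ ops₂ = ∀ (k : ℕ) (L : Language k) → Recognises ops₁ L → Recognises ops₂ L

_⊏_ : {O₁ O₂ : Set} → (O₁ → Automaton) → (O₂ → Automaton) → Set
ops₁ ⊏ ops₂ = (ops₁ ⊑ ops₂) ×
  Σ ℕ λ k → Σ (Language k) λ L → Recognises ops₂ L × ¬ Recognises ops₁ L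

PrimeEnum : (ℕ → ℕ) → Set
PrimeEnum p = (∀ i → Prime (p i))
            × (∀ i j → i < j → p i < p j)
            × (∀ q → Prime q → ∃ λ i → p i ≡ q)

primeCounters : (p : ℕ → ℕ) → PrimeEnum p → (k : ℕ) → Fin k → Automaton
primeCounters p (pr , _) k i = counter (p (toℕ i)) {{prime⇒nonZero (pr (toℕ i))}}

module Submission where

-- The inclusions hold because every operator of the smaller logic is an operator of the larger
-- one.  For strictness let q be the (k+1)-st prime.  A single q-counter whose bit 0 is ⊥ and whose
-- other bits are ⊤ advances by one at every step, so it recognises the unary words whose length
-- is a multiple of q.  Conversely, on unary input every variable of a program using only counters
-- C_p with p < q is eventually periodic with a period d not divisible by q: a counter C_p driven
-- by such inputs gains the same amount over every d steps, so it is periodic with period p·d, and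
-- q ∤ p·d by Euclid's lemma.  Divisibility of the length by q has no such period.

open import Defs
open import Data.Bool using (Bool; true; false; not; _∧_; _∨_)
open import Data.Bool.ListAction using (or)
open import Data.Bool.Properties using (∨-identityʳ)
open import Data.Fin using (Fin; zero; suc; toℕ; fromℕ; inject₁; splitAt; _↑ˡ_; _↑ʳ_; _≟_)
open import Data.Fin.Properties
  using (suc-injective; splitAt-↑ˡ; splitAt-↑ʳ; splitAt⁻¹-↑ˡ; splitAt⁻¹-↑ʳ; toℕ-fromℕ<; fromℕ<-cong;
         toℕ-fromℕ; toℕ-inject₁; toℕ<n)
open import Data.List as List using (map; allFin; tabulate)
open import Data.List.NonEmpty using (_∷_; length)
open import Data.List.Properties using (map-tabulate; map-cong; tabulate-cong; length-replicate)
open import Data.Maybe using (just; nothing; fromMaybe)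
open import Data.Nat as ℕ
  using (ℕ; zero; suc; _+_; _*_; _∸_; _%_; _≤_; _≤′_; ≤′-refl; ≤′-step; s≤s; NonZero)
open import Data.Nat.Properties
  using (+-identityʳ; +-comm; ≤-refl; ≤-trans; m≤n⇒m≤1+n; ≤′⇒≤; ≤⇒≤′; m≤m+n; m≤m*n; m+[n∸m]≡n;
         +-commutativeSemigroup)
open import Algebra.Properties.CommutativeSemigroup +-commutativeSemigroup using (xy∙z≈xz∙y; x∙yz≈xz∙y)
open import Data.Nat.DivMod using (_mod_; m%n<n; %-distribˡ-+; m%n%n≡m%n; %-remove-+ʳ; m*n%n≡0)
open import Data.Nat.Divisibility
  using (_∣_; _∤_; _∣?_; m∣m*n; n∣m*n; ∣m+n∣m⇒∣n; >⇒∤; m%n≡0⇒n∣m; n∣m⇒m%n≡0)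
open import Data.Nat.Primality using (Prime; euclidsLemma; prime⇒nonZero; prime⇒nonTrivial)
open import Data.Product using (Σ; _×_; _,_; proj₁; proj₂)
open import Data.Sum using (inj₁; inj₂)
open import Function using (_∘_; _⇔_; mk⇔)
open import Relation.Nullary using (¬_; yes; no)
open import Relation.Nullary.Decidable using (Dec; ⌊_⌋; ⌊⌋-map′; isYes≗does; does-⇔)
open import Relation.Binary.PropositionalEquality

⌊⌋-⇔ : ∀ {A B : Set} → A ⇔ B → (a? : Dec A) (b? : Dec B) → ⌊ a? ⌋ ≡ ⌊ b? ⌋
⌊⌋-⇔ A⇔B a? b? = trans (isYes≗does a?) (trans (does-⇔ A⇔B a? b?) (sym (isYes≗does b?)))

or-false : ∀ n → or (tabulate {n = n} (λ _ → false)) ≡ false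
or-false zero    = refl
or-false (suc n) = or-false n

or-tabulate-select : ∀ {n} (s : Fin n) (g : Fin n → Bool) →
                     or (tabulate (λ j → ⌊ s ≟ j ⌋ ∧ g j)) ≡ g s
or-tabulate-select {suc n} zero    g = trans (cong (g zero ∨_) (or-false n)) (∨-identityʳ (g zero))
or-tabulate-select {suc n} (suc s) g = trans
  (cong or (tabulate-cong (λ j → cong (_∧ g (suc j)) (⌊⌋-map′ (cong suc) suc-injective (s ≟ j)))))
  (or-tabulate-select s (λ j → g (suc j)))

or-select : ∀ {n} (s : Fin n) (g : Fin n → Bool) → or (map (λ j → ⌊ s ≟ j ⌋ ∧ g j) (allFin n)) ≡ g s
or-select {n} s g =
  trans (cong or (map-tabulate {n = n} (λ j → j) (λ j → ⌊ s ≟ j ⌋ ∧ g j))) (or-tabulate-select s g)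

data SplitView (k v : ℕ) : Fin (k + v) → Set where
  left  : ∀ i → SplitView k v (i ↑ˡ v)
  right : ∀ y → SplitView k v (k ↑ʳ y)

splitView : ∀ k v (x : Fin (k + v)) → SplitView k v x
splitView k v x with splitAt k x in eq
... | inj₁ i = subst (SplitView k v) (splitAt⁻¹-↑ˡ eq) (left i)
... | inj₂ y = subst (SplitView k v) (splitAt⁻¹-↑ʳ eq) (right y)

evalF-cong : ∀ {v} {ρ ρ′ : Fin v → Bool} → (∀ x → ρ x ≡ ρ′ x) → ∀ α → evalF ρ α ≡ evalF ρ′ α
evalF-cong ρ≗ρ′ (var x)  = ρ≗ρ′ x
evalF-cong ρ≗ρ′ ⊤′       = refl
evalF-cong ρ≗ρ′ ⊥′       = refl
evalF-cong ρ≗ρ′ (¬′ α)   = cong not (evalF-cong ρ≗ρ′ α)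
evalF-cong ρ≗ρ′ (α ∧′ β) = cong₂ _∧_ (evalF-cong ρ≗ρ′ α) (evalF-cong ρ≗ρ′ β)
evalF-cong ρ≗ρ′ (α ∨′ β) = cong₂ _∨_ (evalF-cong ρ≗ρ′ α) (evalF-cong ρ≗ρ′ β)

run : (A : Automaton) → (ℕ → Fin (m A) → Bool) → ℕ → Fin (n A)
run A σ zero    = qinit A
run A σ (suc t) = δ A (run A σ t) (σ (suc t))

-- Without function extensionality δ need not respect pointwise equality of its Boolean inputs.
Extensional : Automaton → Set
Extensional A = ∀ j {b b′ : Fin (m A) → Bool} → (∀ r → b r ≡ b′ r) → δ A j b ≡ δ A j b′

run-cong : ∀ A → Extensional A → ∀ {σ σ′} → (∀ u r → σ u r ≡ σ′ u r) →
           ∀ t → run A σ t ≡ run A σ′ t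
run-cong A ext σ≗σ′ zero    = refl
run-cong A ext σ≗σ′ (suc t) rewrite run-cong A ext σ≗σ′ t = ext _ (σ≗σ′ (suc t))

module _ {O : Set} (ops : O → Automaton) where

  holds-dynamic-head : ∀ {k v} (P : Prog ops k v) o args I t (i : Fin (n (ops o))) →
    holds ops (dynamic P o args) I t (i ↑ˡ v) ≡
    ⌊ run (ops o) (λ u r → holds ops P I u (args r)) t ≟ i ⌋
  holds-dynamic-head {v = v} P o args I zero    i rewrite splitAt-↑ˡ (n (ops o)) i v = refl
  holds-dynamic-head {v = v} P o args I (suc t) i rewrite splitAt-↑ˡ (n (ops o)) i v = begin
    or (map (λ j → holds ops (dynamic P o args) I t (j ↑ˡ v) ∧ step j) (allFin _))
      ≡⟨ cong or (map-cong (λ j → cong (_∧ step j) (holds-dynamic-head P o args I t j)) (allFin _)) ⟩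
    or (map (λ j → ⌊ run (ops o) σ t ≟ j ⌋ ∧ step j) (allFin _))
      ≡⟨ or-select (run (ops o) σ t) step ⟩
    step (run (ops o) σ t) ∎
    where
    open ≡-Reasoning
    σ = λ u r → holds ops P I u (args r)
    step = λ j → ⌊ δ (ops o) j (σ (suc t)) ≟ i ⌋

  holds-dynamic-body : ∀ {k v} (P : Prog ops k v) o args I t (y : Fin v) →
    holds ops (dynamic P o args) I t (n (ops o) ↑ʳ y) ≡ holds ops P I t y
  holds-dynamic-body {v = v} P o args I t y rewrite splitAt-↑ʳ (n (ops o)) v y = refl

module _ {O : Set} {ops : O → Automaton} (ext : ∀ o → Extensional (ops o)) where

  holds-cong : ∀ {k v} (P : Prog ops k v) {I I′ : ℕ → Fin k → Bool} →
    (∀ t x → I t x ≡ I′ t x) → ∀ t x → holds ops P I t x ≡ holds ops P I′ t x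
  holds-cong inputs       I≗I′ t x               = I≗I′ t x
  holds-cong (static P α) I≗I′ t       zero    = evalF-cong (holds-cong P I≗I′ t) α
  holds-cong (static P α) I≗I′ t       (suc x) = holds-cong P I≗I′ t x
  holds-cong (delay P y)  I≗I′ zero    zero    = refl
  holds-cong (delay P y)  I≗I′ (suc t) zero    = holds-cong P I≗I′ t y
  holds-cong (delay P y)  I≗I′ zero    (suc x) = holds-cong P I≗I′ zero x
  holds-cong (delay P y)  I≗I′ (suc t) (suc x) = holds-cong P I≗I′ (suc t) x
  holds-cong (dynamic {v} P o args) {I} {I′} I≗I′ t x with splitView (n (ops o)) v x
  ... | left i  = begin
    holds ops (dynamic P o args) I t (i ↑ˡ v)   ≡⟨ holds-dynamic-head ops P o args I t i ⟩
    ⌊ run (ops o) _ t ≟ i ⌋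
      ≡⟨ cong (⌊_⌋ ∘ (_≟ i)) (run-cong (ops o) (ext o) (λ u r → holds-cong P I≗I′ u (args r)) t) ⟩
    ⌊ run (ops o) _ t ≟ i ⌋                     ≡⟨ holds-dynamic-head ops P o args I′ t i ⟨
    holds ops (dynamic P o args) I′ t (i ↑ˡ v)  ∎
    where open ≡-Reasoning
  ... | right y = begin
    holds ops (dynamic P o args) I t (n (ops o) ↑ʳ y)   ≡⟨ holds-dynamic-body ops P o args I t y ⟩
    holds ops P I t y                                   ≡⟨ holds-cong P I≗I′ t y ⟩
    holds ops P I′ t y                                  ≡⟨ holds-dynamic-body ops P o args I′ t y ⟨
    holds ops (dynamic P o args) I′ t (n (ops o) ↑ʳ y)  ∎
    where open ≡-Reasoning

module _ {O : Set} {ops : O → Automaton} where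

  dynamicVia : ∀ {k v o A} → ops o ≡ A → Prog ops k v → (Fin (m A) → Fin v) → Prog ops k (n A + v)
  dynamicVia {o = o} refl P args = dynamic P o args

  holds-dynamicVia-head : ∀ {k v o A} (o≡A : ops o ≡ A) (P : Prog ops k v) args I t (i : Fin (n A)) →
    holds ops (dynamicVia o≡A P args) I t (i ↑ˡ v) ≡ ⌊ run A (λ u r → holds ops P I u (args r)) t ≟ i ⌋
  holds-dynamicVia-head {o = o} refl P = holds-dynamic-head ops P o

  holds-dynamicVia-body : ∀ {k v o A} (o≡A : ops o ≡ A) (P : Prog ops k v) args I t (y : Fin v) →
    holds ops (dynamicVia o≡A P args) I t (n A ↑ʳ y) ≡ holds ops P I t y
  holds-dynamicVia-body {o = o} refl P = holds-dynamic-body ops P o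

module _ {O₁ O₂ : Set} {ops₁ : O₁ → Automaton} {ops₂ : O₂ → Automaton}
         (f : O₁ → O₂) (ops₂∘f≡ops₁ : ∀ o → ops₂ (f o) ≡ ops₁ o) (ext : ∀ o → Extensional (ops₁ o)) where

  translate : ∀ {k v} → Prog ops₁ k v → Prog ops₂ k v
  translate inputs             = inputs
  translate (static P α)       = static (translate P) α
  translate (delay P y)        = delay (translate P) y
  translate (dynamic P o args) = dynamicVia (ops₂∘f≡ops₁ o) (translate P) args

  holds-translate : ∀ {k v} (P : Prog ops₁ k v) I t x → holds ops₂ (translate P) I t x ≡ holds ops₁ P I t x
  holds-translate inputs       I t       x       = refl
  holds-translate (static P α) I t       zero    = evalF-cong (holds-translate P I t) α
  holds-translate (static P α) I t       (suc x) = holds-translate P I t x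
  holds-translate (delay P y)  I zero    zero    = refl
  holds-translate (delay P y)  I (suc t) zero    = holds-translate P I t y
  holds-translate (delay P y)  I zero    (suc x) = holds-translate P I zero x
  holds-translate (delay P y)  I (suc t) (suc x) = holds-translate P I (suc t) x
  holds-translate (dynamic {v} P o args) I t x with splitView (n (ops₁ o)) v x
  ... | left i  = begin
    holds ops₂ (translate (dynamic P o args)) I t (i ↑ˡ v)
      ≡⟨ holds-dynamicVia-head (ops₂∘f≡ops₁ o) (translate P) args I t i ⟩
    ⌊ run (ops₁ o) _ t ≟ i ⌋
      ≡⟨ cong (⌊_⌋ ∘ (_≟ i)) (run-cong (ops₁ o) (ext o) (λ u r → holds-translate P I u (args r)) t) ⟩
    ⌊ run (ops₁ o) _ t ≟ i ⌋
      ≡⟨ holds-dynamic-head ops₁ P o args I t i ⟨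
    holds ops₁ (dynamic P o args) I t (i ↑ˡ v)
      ∎
    where open ≡-Reasoning
  ... | right y = begin
    holds ops₂ (translate (dynamic P o args)) I t (n (ops₁ o) ↑ʳ y)
      ≡⟨ holds-dynamicVia-body (ops₂∘f≡ops₁ o) (translate P) args I t y ⟩
    holds ops₂ (translate P) I t y
      ≡⟨ holds-translate P I t y ⟩
    holds ops₁ P I t y
      ≡⟨ holds-dynamic-body ops₁ P o args I t y ⟨
    holds ops₁ (dynamic P o args) I t (n (ops₁ o) ↑ʳ y)
      ∎
    where open ≡-Reasoning

  translate-⊑ : ops₁ ⊑ ops₂
  translate-⊑ k L (v , P , a , P-recognises) =
    v , translate P , a , λ w → trans (holds-translate P (interp w) (length w) a) (P-recognises w)

firstTrue-cong : ∀ m {b b′ : Fin m → Bool} → (∀ r → b r ≡ b′ r) → firstTrue m b ≡ firstTrue m b′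
firstTrue-cong zero    b≗b′ = refl
firstTrue-cong (suc m) {b} {b′} b≗b′ with b zero | b′ zero | b≗b′ zero
... | true  | true  | refl = refl
... | false | false | refl rewrite firstTrue-cong m (λ r → b≗b′ (suc r)) with firstTrue m (λ r → b′ (suc r))
...   | just _  = refl
...   | nothing = refl

increment : ∀ q → (Fin q → Bool) → ℕ
increment q b = fromMaybe 0 (firstTrue q b)

counter-extensional : ∀ q .{{_ : NonZero q}} → Extensional (counter q)
counter-extensional q j b≗b′ = cong (λ c → (toℕ j + fromMaybe 0 c) mod q) (firstTrue-cong q b≗b′)

counters : {O : Set} (size : O → ℕ) → (∀ o → NonZero (size o)) → O → Automaton
counters size size≢0 o = counter (size o) {{size≢0 o}}

runningSum : (ℕ → ℕ) → ℕ → ℕ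
runningSum g zero    = 0
runningSum g (suc t) = runningSum g t + g (suc t)

runningSum-ones : ∀ t → runningSum (λ _ → 1) t ≡ t
runningSum-ones zero    = refl
runningSum-ones (suc t) = trans (cong (_+ 1) (runningSum-ones t)) (+-comm t 1)

runningSum-monotone : ∀ g {t t′} → t ≤′ t′ → runningSum g t ≤ runningSum g t′
runningSum-monotone g ≤′-refl         = ≤-refl
runningSum-monotone g (≤′-step t≤t′) = ≤-trans (runningSum-monotone g t≤t′) (m≤m+n _ _)

%-cong⇒mod-cong : ∀ {a b} q .{{_ : NonZero q}} → a % q ≡ b % q → a mod q ≡ b mod q
%-cong⇒mod-cong {a} {b} q a%q≡b%q = fromℕ<-cong _ _ a%q≡b%q (m%n<n a q) (m%n<n b q)

mod≡0mod⇔∣ : ∀ q .{{_ : NonZero q}} ℓ → (ℓ mod q ≡ 0 mod q) ⇔ q ∣ ℓ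
mod≡0mod⇔∣ q ℓ = mk⇔
  (λ ℓmodq≡0 → m%n≡0⇒n∣m ℓ q (begin
    ℓ % q          ≡⟨ toℕ-fromℕ< (m%n<n ℓ q) ⟨
    toℕ (ℓ mod q)  ≡⟨ cong toℕ ℓmodq≡0 ⟩
    toℕ (0 mod q)  ≡⟨ toℕ-fromℕ< (m%n<n 0 q) ⟩
    0 % q          ≡⟨ m*n%n≡0 0 q ⟩
    0              ∎))
  (λ q∣ℓ → %-cong⇒mod-cong q (trans (n∣m⇒m%n≡0 ℓ q q∣ℓ) (sym (m*n%n≡0 0 q))))
  where open ≡-Reasoning

run-counter : ∀ q .{{_ : NonZero q}} σ t →
  run (counter q) σ t ≡ runningSum (λ u → increment q (σ u)) t mod q
run-counter q σ zero    = refl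
run-counter q σ (suc t) rewrite run-counter q σ t = %-cong⇒mod-cong q (begin
  (toℕ (S mod q) + j) % q  ≡⟨ cong (λ s → (s + j) % q) (toℕ-fromℕ< (m%n<n S q)) ⟩
  (S % q + j) % q          ≡⟨ %-distribˡ-+ (S % q) j q ⟩
  (S % q % q + j % q) % q  ≡⟨ cong (λ s → (s + j % q) % q) (m%n%n≡m%n S q) ⟩
  (S % q + j % q) % q      ≡⟨ %-distribˡ-+ S j q ⟨
  (S + j) % q              ∎)
  where
  open ≡-Reasoning
  S = runningSum (λ u → increment q (σ u)) t
  j = increment q (σ (suc t))

PeriodicFrom : {A : Set} → ℕ → ℕ → (ℕ → A) → Set
PeriodicFrom T d f = ∀ t → T ≤ t → f (t + d) ≡ f t

periodicFrom-* : ∀ {A : Set} {T d} {f : ℕ → A} → PeriodicFrom T d f → ∀ c → PeriodicFrom T (c * d) f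
periodicFrom-* {f = f} f-periodic zero    t T≤t = cong f (+-identityʳ t)
periodicFrom-* {d = d} {f} f-periodic (suc c) t T≤t = begin
  f (t + (d + c * d))  ≡⟨ cong f (x∙yz≈xz∙y t d (c * d)) ⟩
  f (t + c * d + d)    ≡⟨ f-periodic (t + c * d) (≤-trans T≤t (m≤m+n t (c * d))) ⟩
  f (t + c * d)        ≡⟨ periodicFrom-* f-periodic c t T≤t ⟩
  f t                  ∎
  where open ≡-Reasoning

module _ {g : ℕ → ℕ} {T d : ℕ} (g-periodic : PeriodicFrom T d g) where

  private
    R = runningSum g
    gain = R (T + d) ∸ R T

  runningSum-shift : ∀ {t} → T ≤′ t → R (t + d) ≡ R t + gain
  runningSum-shift ≤′-refl           = sym (m+[n∸m]≡n (runningSum-monotone g (≤⇒≤′ (m≤m+n T d))))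
  runningSum-shift (≤′-step {t} T≤t) = begin
    R (t + d) + g (suc t + d)
      ≡⟨ cong₂ _+_ (runningSum-shift T≤t) (g-periodic (suc t) (m≤n⇒m≤1+n (≤′⇒≤ T≤t))) ⟩
    R t + gain + g (suc t)
      ≡⟨ xy∙z≈xz∙y (R t) gain (g (suc t)) ⟩
    R t + g (suc t) + gain
      ∎
    where open ≡-Reasoning

  runningSum-shifts : ∀ {t} → T ≤ t → ∀ c → R (t + c * d) ≡ R t + c * gain
  runningSum-shifts {t} T≤t zero    = trans (cong R (+-identityʳ t)) (sym (+-identityʳ (R t)))
  runningSum-shifts {t} T≤t (suc c) = begin
    R (t + (d + c * d))      ≡⟨ cong R (x∙yz≈xz∙y t d (c * d)) ⟩
    R (t + c * d + d)        ≡⟨ runningSum-shift (≤⇒≤′ (≤-trans T≤t (m≤m+n t (c * d)))) ⟩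
    R (t + c * d) + gain     ≡⟨ cong (_+ gain) (runningSum-shifts T≤t c) ⟩
    R t + c * gain + gain    ≡⟨ x∙yz≈xz∙y (R t) gain (c * gain) ⟨
    R t + (gain + c * gain)  ∎
    where open ≡-Reasoning

  runningSum-%-periodic : ∀ q .{{_ : NonZero q}} → PeriodicFrom T (q * d) (λ t → R t % q)
  runningSum-%-periodic q t T≤t = begin
    R (t + q * d) % q     ≡⟨ cong (_% q) (runningSum-shifts T≤t q) ⟩
    (R t + q * gain) % q  ≡⟨ %-remove-+ʳ (R t) (m∣m*n gain) ⟩
    R t % q               ∎
    where open ≡-Reasoning

run-counter-periodic : ∀ q .{{_ : NonZero q}} {σ : ℕ → Fin q → Bool} {T d} →
  (∀ r → PeriodicFrom T d (λ t → σ t r)) → PeriodicFrom T (q * d) (run (counter q) σ)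
run-counter-periodic q {σ} {T} {d} σ-periodic t T≤t = begin
  run (counter q) σ (t + q * d)   ≡⟨ run-counter q σ (t + q * d) ⟩
  runningSum g (t + q * d) mod q  ≡⟨ %-cong⇒mod-cong q (runningSum-%-periodic g-periodic q t T≤t) ⟩
  runningSum g t mod q            ≡⟨ run-counter q σ t ⟨
  run (counter q) σ t             ∎
  where
  open ≡-Reasoning
  g = λ u → increment q (σ u)
  g-periodic : PeriodicFrom T d g
  g-periodic u T≤u = cong (fromMaybe 0) (firstTrue-cong q (λ r → σ-periodic r u T≤u))

EventuallyPeriodicPrimeTo : ℕ → ∀ {v} → (ℕ → Fin v → Bool) → Set
EventuallyPeriodicPrimeTo q {v} f = Σ ℕ λ T → Σ ℕ λ d → q ∤ d × (∀ x → PeriodicFrom T d (λ t → f t x))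

module _ {q} (q-prime : Prime q) {O : Set} {size : O → ℕ} {size≢0 : ∀ o → NonZero (size o)}
         (q∤size : ∀ o → q ∤ size o)
         {k} {I : ℕ → Fin k → Bool} (I-periodic : EventuallyPeriodicPrimeTo q I) where

  private
    ops = counters size size≢0

  holds-eventuallyPeriodic : ∀ {v} (P : Prog ops k v) → EventuallyPeriodicPrimeTo q (holds ops P I)
  holds-eventuallyPeriodic inputs = I-periodic
  holds-eventuallyPeriodic (static P α) with holds-eventuallyPeriodic P
  ... | T , d , q∤d , P-periodic = T , d , q∤d , periodic
    where
    periodic : ∀ x → PeriodicFrom T d (λ t → holds ops (static P α) I t x)
    periodic zero    t T≤t = evalF-cong (λ x → P-periodic x t T≤t) α
    periodic (suc x)       = P-periodic x
  holds-eventuallyPeriodic (delay P y) with holds-eventuallyPeriodic P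
  ... | T , d , q∤d , P-periodic = suc T , d , q∤d , periodic
    where
    periodic : ∀ x → PeriodicFrom (suc T) d (λ t → holds ops (delay P y) I t x)
    periodic zero    (suc t) (s≤s T≤t) = P-periodic y t T≤t
    periodic (suc x) (suc t) (s≤s T≤t) = P-periodic x (suc t) (m≤n⇒m≤1+n T≤t)
  holds-eventuallyPeriodic (dynamic {v} P o args) with holds-eventuallyPeriodic P
  ... | T , d , q∤d , P-periodic = T , size o * d , q∤size*d , periodic
    where
    instance _ = size≢0 o

    q∤size*d : q ∤ size o * d
    q∤size*d q∣size*d with euclidsLemma (size o) d q-prime q∣size*d
    ... | inj₁ q∣size = q∤size o q∣size
    ... | inj₂ q∣d    = q∤d q∣d

    periodic : ∀ x → PeriodicFrom T (size o * d) (λ t → holds ops (dynamic P o args) I t x)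
    periodic x with splitView (size o) v x
    ... | left i  = λ t T≤t → begin
      holds ops (dynamic P o args) I (t + size o * d) (i ↑ˡ v)
        ≡⟨ holds-dynamic-head ops P o args I _ i ⟩
      ⌊ run (counter (size o)) σ (t + size o * d) ≟ i ⌋
        ≡⟨ cong (⌊_⌋ ∘ (_≟ i)) (run-counter-periodic (size o) (λ r → P-periodic (args r)) t T≤t) ⟩
      ⌊ run (counter (size o)) σ t ≟ i ⌋
        ≡⟨ holds-dynamic-head ops P o args I t i ⟨
      holds ops (dynamic P o args) I t (i ↑ˡ v)
        ∎
      where
      open ≡-Reasoning
      σ = λ u r → holds ops P I u (args r)
    ... | right y = λ t T≤t → begin
      holds ops (dynamic P o args) I (t + size o * d) (size o ↑ʳ y)
        ≡⟨ holds-dynamic-body ops P o args I _ y ⟩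
      holds ops P I (t + size o * d) y
        ≡⟨ periodicFrom-* (P-periodic y) (size o) t T≤t ⟩
      holds ops P I t y
        ≡⟨ holds-dynamic-body ops P o args I t y ⟨
      holds ops (dynamic P o args) I t (size o ↑ʳ y)
        ∎
      where open ≡-Reasoning

multiplesOf : ℕ → Language 0
multiplesOf q w = ⌊ q ∣? length w ⌋

multiples-notPeriodic : ∀ {q} .{{_ : NonZero q}} {T d} → q ∤ d → ¬ PeriodicFrom T d (λ ℓ → ⌊ q ∣? ℓ ⌋)
multiples-notPeriodic {q} {T} {d} q∤d periodic
  with q ∣? T * q | q ∣? T * q + d | periodic (T * q) (m≤m*n T q)
... | no q∤Tq  | _          | _ = q∤Tq (n∣m*n T)
... | yes q∣Tq | yes q∣Tq+d | _ = q∤d (∣m+n∣m⇒∣n q∣Tq+d q∣Tq)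
... | yes _    | no _       | ()

unaryWord : ℕ → Word 0
unaryWord ℓ = (λ ()) ∷ List.replicate ℓ (λ ())

length-unaryWord : ∀ ℓ → length (unaryWord ℓ) ≡ suc ℓ
length-unaryWord ℓ = cong suc (length-replicate ℓ)

noInput : ℕ → Fin 0 → Bool
noInput t ()

noInput-periodic : ∀ {q} → Prime q → EventuallyPeriodicPrimeTo q noInput
noInput-periodic {q} q-prime = 0 , 1 , >⇒∤ (ℕ.nonTrivial⇒n>1 q {{prime⇒nonTrivial q-prime}}) , λ ()

holds-unaryWord : ∀ {O} {ops : O → Automaton} → (∀ o → Extensional (ops o)) →
  ∀ {L : Language 0} {v} (P : Prog ops 0 v) a → (∀ w → holds ops P (interp w) (length w) a ≡ L w) →
  ∀ ℓ → holds ops P noInput (suc ℓ) a ≡ L (unaryWord ℓ)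
holds-unaryWord {ops = ops} ext {L} P a P-recognises ℓ = begin
  holds ops P noInput (suc ℓ) a        ≡⟨ holds-cong ext P (λ t ()) (suc ℓ) a ⟩
  holds ops P (interp w) (suc ℓ) a     ≡⟨ cong (λ t → holds ops P (interp w) t a) (length-unaryWord ℓ) ⟨
  holds ops P (interp w) (length w) a  ≡⟨ P-recognises w ⟩
  L w                                  ∎
  where
  open ≡-Reasoning
  w = unaryWord ℓ

multiplesOf-notRecognised : ∀ {q} → Prime q → ∀ {O} {size : O → ℕ} {size≢0 : ∀ o → NonZero (size o)} →
  (∀ o → q ∤ size o) → ¬ Recognises (counters size size≢0) (multiplesOf q)
multiplesOf-notRecognised {q} q-prime {size = size} {size≢0} q∤size (v , P , a , P-recognises)
  with holds-eventuallyPeriodic q-prime {size≢0 = size≢0} q∤size (noInput-periodic q-prime) P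
... | T , d , q∤d , P-periodic = multiples-notPeriodic q∤d multiples-periodic
  where
  instance _ = prime⇒nonZero q-prime
  ops = counters size size≢0

  holds≡multiples : ∀ ℓ → holds ops P noInput (suc ℓ) a ≡ ⌊ q ∣? suc ℓ ⌋
  holds≡multiples ℓ = trans
    (holds-unaryWord (λ o → counter-extensional (size o) {{size≢0 o}}) P a P-recognises ℓ)
    (cong (⌊_⌋ ∘ (q ∣?_)) (length-unaryWord ℓ))

  multiples-periodic : PeriodicFrom (suc T) d (λ ℓ → ⌊ q ∣? ℓ ⌋)
  multiples-periodic (suc t) (s≤s T≤t) = begin
    ⌊ q ∣? suc (t + d) ⌋             ≡⟨ holds≡multiples (t + d) ⟨
    holds ops P noInput (suc t + d) a  ≡⟨ P-periodic a (suc t) (m≤n⇒m≤1+n T≤t) ⟩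
    holds ops P noInput (suc t) a      ≡⟨ holds≡multiples t ⟩
    ⌊ q ∣? suc t ⌋                   ∎
    where open ≡-Reasoning

counter-recognises-multiplesOf : ∀ {O} (ops : O → Automaton) o {q} .{{_ : NonZero q}} →
  ops o ≡ counter q → 2 ≤ q → Recognises ops (multiplesOf q)
counter-recognises-multiplesOf ops o {q@(suc (suc _))} o≡counter (s≤s (s≤s _)) =
  _ , P , 0 mod q ↑ˡ 2 , P-recognises
  where
  constants : Prog ops 0 2
  constants = static (static inputs ⊥′) ⊤′

  -- In constants, zero is the ⊤ variable and suc zero the ⊥ one; so bit 0 reads ⊥, all others ⊤.
  firstTrueAt1 : Fin q → Fin 2
  firstTrueAt1 zero    = suc zero
  firstTrueAt1 (suc _) = zero

  P = dynamicVia o≡counter constants firstTrueAt1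

  P-recognises : ∀ w → holds ops P (interp w) (length w) (0 mod q ↑ˡ 2) ≡ ⌊ q ∣? length w ⌋
  P-recognises w = begin
    holds ops P (interp w) ℓ (0 mod q ↑ˡ 2)
      ≡⟨ holds-dynamicVia-head o≡counter constants firstTrueAt1 (interp w) ℓ (0 mod q) ⟩
    ⌊ run (counter q) σ ℓ ≟ 0 mod q ⌋
      ≡⟨ cong (⌊_⌋ ∘ (_≟ 0 mod q)) (run-counter q σ ℓ) ⟩
    ⌊ runningSum (λ _ → 1) ℓ mod q ≟ 0 mod q ⌋
      ≡⟨ cong (⌊_⌋ ∘ (_≟ 0 mod q) ∘ (_mod q)) (runningSum-ones ℓ) ⟩
    ⌊ ℓ mod q ≟ 0 mod q ⌋
      ≡⟨ ⌊⌋-⇔ (mod≡0mod⇔∣ q ℓ) _ _ ⟩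
    ⌊ q ∣? ℓ ⌋
      ∎
    where
    open ≡-Reasoning
    ℓ = length w
    σ : ℕ → Fin q → Bool
    σ u r = holds ops constants (interp w) u (firstTrueAt1 r)

module _ (p : ℕ → ℕ) (pe : PrimeEnum p) where

  private
    prime      = proj₁ pe
    increasing = proj₁ (proj₂ pe)

    instance
      p-nonZero : ∀ {i} → NonZero (p i)
      p-nonZero {i} = prime⇒nonZero (prime i)

    counterAt : ℕ → Automaton
    counterAt i = counter (p i)

  primeCounters-⊑ : ∀ k → primeCounters p pe k ⊑ primeCounters p pe (suc k)
  primeCounters-⊑ k =
    translate-⊑ inject₁ (λ o → cong counterAt (toℕ-inject₁ o)) (λ o → counter-extensional (p (toℕ o)))

  primeCounters-suc-recognises : ∀ k → Recognises (primeCounters p pe (suc k)) (multiplesOf (p k))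
  primeCounters-suc-recognises k = counter-recognises-multiplesOf _ (fromℕ k)
    (cong counterAt (toℕ-fromℕ k)) (ℕ.nonTrivial⇒n>1 (p k) {{prime⇒nonTrivial (prime k)}})

  primeCounters-notRecognises : ∀ k → ¬ Recognises (primeCounters p pe k) (multiplesOf (p k))
  primeCounters-notRecognises k = multiplesOf-notRecognised (prime k) {size = p ∘ toℕ} {λ _ → p-nonZero}
    (λ o → >⇒∤ (increasing (toℕ o) k (toℕ<n o)))

corollary1 : (p : ℕ → ℕ) (pe : PrimeEnum p) (k : ℕ) → 1 ≤ k →
    primeCounters p pe k ⊏ primeCounters p pe (suc k)
corollary1 p pe k _ =
  primeCounters-⊑ p pe k , 0 , multiplesOf (p k) ,
  primeCounters-suc-recognises p pe k , primeCounters-notRecognises p pe k
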